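{- For every integer $n\geq 2$, $m_2(K_{1,2}, P_4, nK_2)= n+1$.
   Context: $K_{2\times t}=K_{t,t}$ is the complete bipartite graph with both parts of size $t$. $m_2(G_1,G_2,G_3)$ is the smallest positive integer $t$ such that every 3-coloring of the edges of $K_{t,t}$ contains, for some $i\in\{1,2,3\}$, a copy of $G_i$ all of whose edges have color $i$. $K_{1,2}$ is the path on 3 vertices, $P_4$ the path on 4 vertices, and $nK_2$ the matching of $n$ disjoint edges. -}

module Defs where

open import Data.Nat using (ℕ; zero; suc; _<_; _≤_; _+_)
open import Data.Fin using (Fin; zero; suc)
open import Data.Product using (Σ; ∃; _×_; _,_; proj₁; proj₂)
open import Data.Sum using (_⊎_; inj₁; inj₂)
open import Data.Empty using (⊥)
open import Relation.Binary.PropositionalEquality using (_≡_)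
open import Relation.Nullary using (¬_)
open import Function.Definitions using (Injective)

record Graph : Set₁ where
  field
    Vertex : Set
    Edge   : Set
    ends   : Edge → Vertex × Vertex
open Graph public

-- Vertices of K_{t,t}: left part (inj₁) and right part (inj₂).
BipVertex : ℕ → Set
BipVertex t = Fin t ⊎ Fin t

-- A 3-colouring of the edges of K_{t,t}: edge {a (left), b (right)} gets colour c a b.
Colouring : ℕ → Set
Colouring t = Fin t → Fin t → Fin 3

EdgeOfColour : ∀ {t} → Colouring t → BipVertex t → BipVertex t → Fin 3 → Set
EdgeOfColour c (inj₁ a) (inj₂ b) i = c a b ≡ i
EdgeOfColour c (inj₂ b) (inj₁ a) i = c a b ≡ i
EdgeOfColour c (inj₁ _) (inj₁ _) i = ⊥
EdgeOfColour c (inj₂ _) (inj₂ _) i = ⊥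

HasMonoCopy : ∀ {t} → Colouring t → Fin 3 → Graph → Set
HasMonoCopy {t} c i H =
  Σ (Vertex H → BipVertex t) λ f →
    Injective _≡_ _≡_ f ×
    ((e : Edge H) → EdgeOfColour c (f (proj₁ (ends H e))) (f (proj₂ (ends H e))) i)

pick : Graph → Graph → Graph → Fin 3 → Graph
pick G₁ G₂ G₃ zero = G₁
pick G₁ G₂ G₃ (suc zero) = G₂
pick G₁ G₂ G₃ (suc (suc zero)) = G₃

Arrows : ℕ → Graph → Graph → Graph → Set
Arrows t G₁ G₂ G₃ = (c : Colouring t) → ∃ λ (i : Fin 3) → HasMonoCopy c i (pick G₁ G₂ G₃ i)

M2≡ : Graph → Graph → Graph → ℕ → Set
M2≡ G₁ G₂ G₃ m =
  (1 ≤ m) × Arrows m G₁ G₂ G₃ × ((t : ℕ) → 1 ≤ t → t < m → ¬ Arrows t G₁ G₂ G₃)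

K12 : Graph
K12 = record
  { Vertex = Fin 3
  ; Edge = Fin 2
  ; ends = λ { zero → (zero , suc zero) ; (suc zero) → (zero , suc (suc zero)) }
  }

P4 : Graph
P4 = record
  { Vertex = Fin 4
  ; Edge = Fin 3
  ; ends = λ { zero → (zero , suc zero)
             ; (suc zero) → (suc zero , suc (suc zero))
             ; (suc (suc zero)) → (suc (suc zero) , suc (suc (suc zero))) }
  }

matching : ℕ → Graph
matching n = record
  { Vertex = Fin n × Fin 2
  ; Edge = Fin n
  ; ends = λ k → ((k , zero) , (k , suc zero))
  }

-- A colour-0 K_{1,2} is two colour-0 edges at a vertex; a colour-1 P_4 appears as soon
-- as a vertex has two colour-1 edges and another vertex meets one of their ends in
-- colour 1. Hence two rows and three columns of a colouring avoiding both always contain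
-- a colour-2 edge: otherwise the first row has two entries of colour 1, and the second
-- row must then have colour 0 in both of those columns.
-- Upper bound: for t > 3 pick such an edge ab and recurse on K_{t,t} minus a and b,
-- extending the matching found there by ab; on K_{3,3} the same fact, applied off the
-- row of a and off the column of b, yields two disjoint colour-2 edges.
-- Lower bound: on K_{n,n} colour the first row 1 and the others 2. Every colour-1 edge
-- meets one fixed vertex and every colour-2 edge one of n - 1 vertices, so there is no
-- colour-1 2K_2 (let alone P_4) and no colour-2 nK_2.
module Submission where

open import Defs
open import Data.Nat using (ℕ; zero; suc; _≤_; _<_; _+_; z≤n; s≤s)
open import Data.Nat.Properties using (+-comm; ≤⇒≯; m<1+n⇒m≤n)
open import Data.Fin using (Fin; zero; suc; punchIn; _↑ˡ_; combine)
open import Data.Fin.Patterns using (0F; 1F; 2F)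
open import Data.Fin.Properties using (_≟_; punchIn-injective; punchInᵢ≢i; ↑ˡ-injective; combine-injective; injective⇒≤)
open import Data.Product using (∃; ∃₂; _×_; _,_; proj₁; uncurry)
open import Data.Product.Properties using (×-≡,≡→≡)
open import Data.Sum as Sum using (_⊎_; inj₁; inj₂; swap)
open import Data.Sum.Properties using (inj₁-injective; inj₂-injective; swap-involutive)
open import Data.Vec.Functional using ([]; _∷_)
open import Data.Empty using (⊥-elim)
open import Function using (_∘_; id; flip)
open import Function.Definitions using (Injective)
open import Relation.Binary.PropositionalEquality using (_≡_; _≢_; refl; sym; trans; cong; subst; ≢-sym)
open import Relation.Nullary using (¬_; yes; no)

private variable
  A : Set
  n s t m : ℕ
  i : Fin 3
  H : Graph

[]-injective : Injective _≡_ _≡_ ([] {A = A})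
[]-injective {x = ()}

∷-injective : {x : A} {f : Fin n → A} → (∀ k → f k ≢ x) → Injective _≡_ _≡_ f →
              Injective _≡_ _≡_ (x ∷ f)
∷-injective x∉f f-inj {0F}    {0F}    _  = refl
∷-injective x∉f f-inj {0F}    {suc k} eq = ⊥-elim (x∉f k (sym eq))
∷-injective x∉f f-inj {suc j} {0F}    eq = ⊥-elim (x∉f j eq)
∷-injective x∉f f-inj {suc j} {suc k} eq = cong suc (f-inj eq)

record ColouredEmbedding (c′ : Colouring s) (c : Colouring t) : Set where
  field
    vertex    : BipVertex s → BipVertex t
    injective : Injective _≡_ _≡_ vertex
    edge      : ∀ x y {i} → EdgeOfColour c′ x y i → EdgeOfColour c (vertex x) (vertex y) i

  copy : HasMonoCopy c′ i H → HasMonoCopy c i H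
  copy (f , f-inj , f-edge) = vertex ∘ f , f-inj ∘ injective , λ e → edge _ _ (f-edge e)

restrict : Colouring t → (Fin s → Fin t) → (Fin s → Fin t) → Colouring s
restrict c row col a b = c (row a) (col b)

restriction : (c : Colouring t) {row col : Fin s → Fin t} →
              Injective _≡_ _≡_ row → Injective _≡_ _≡_ col →
              ColouredEmbedding (restrict c row col) c
restriction c {row} {col} row-inj col-inj = record
  { vertex = Sum.map row col ; injective = injective ; edge = edge }
  where
  injective : Injective _≡_ _≡_ (Sum.map row col)
  injective {inj₁ _} {inj₁ _} eq = cong inj₁ (row-inj (inj₁-injective eq))
  injective {inj₂ _} {inj₂ _} eq = cong inj₂ (col-inj (inj₂-injective eq))
  edge : ∀ x y {i} → EdgeOfColour (restrict c row col) x y i →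
         EdgeOfColour c (Sum.map row col x) (Sum.map row col y) i
  edge (inj₁ _) (inj₂ _) e = e
  edge (inj₂ _) (inj₁ _) e = e

transposition : (c : Colouring t) → ColouredEmbedding (flip c) c
transposition c = record { vertex = swap ; injective = injective ; edge = edge }
  where
  injective : Injective _≡_ _≡_ (swap {A = Fin _} {B = Fin _})
  injective {x} {y} eq = trans (sym (swap-involutive x)) (trans (cong swap eq) (swap-involutive y))
  edge : ∀ x y {i} → EdgeOfColour (flip c) x y i → EdgeOfColour c (swap x) (swap y) i
  edge (inj₁ _) (inj₂ _) e = e
  edge (inj₂ _) (inj₁ _) e = e

K12-or-P4 : Colouring t → Set
K12-or-P4 c = HasMonoCopy c 0F K12 ⊎ HasMonoCopy c 1F P4

K12-or-P4-transfer : {c′ : Colouring s} {c : Colouring t} → ColouredEmbedding c′ c →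
                     K12-or-P4 c′ → K12-or-P4 c
K12-or-P4-transfer φ = Sum.map copy copy
  where open ColouredEmbedding φ

module _ {t} (c : Colouring t) where

  cherry : ∀ {a b b′} → b ≢ b′ → c a b ≡ i → c a b′ ≡ i → HasMonoCopy c i K12
  cherry {a = a} {b} {b′} b≢b′ ab ab′ =
    inj₁ a ∷ inj₂ b ∷ inj₂ b′ ∷ [] ,
    ∷-injective (λ { 0F () ; 1F () })
      (∷-injective (λ { 0F → b≢b′ ∘ sym ∘ inj₂-injective })
        (∷-injective (λ ()) []-injective)) ,
    λ { 0F → ab ; 1F → ab′ }

  zigzag : ∀ {a a′ b b′} → a ≢ a′ → b ≢ b′ → c a b ≡ i → c a′ b ≡ i → c a′ b′ ≡ i →
           HasMonoCopy c i P4
  zigzag {a = a} {a′} {b} {b′} a≢a′ b≢b′ ab a′b a′b′ =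
    inj₁ a ∷ inj₂ b ∷ inj₁ a′ ∷ inj₂ b′ ∷ [] ,
    ∷-injective (λ { 0F () ; 1F → a≢a′ ∘ sym ∘ inj₁-injective ; 2F () })
      (∷-injective (λ { 0F () ; 1F → b≢b′ ∘ sym ∘ inj₂-injective })
        (∷-injective (λ { 0F () }) (∷-injective (λ ()) []-injective))) ,
    λ { 0F → ab ; 1F → a′b ; 2F → a′b′ }

module _ {t} (c : Colouring t) (row : Fin 2 → Fin t) (col : Fin 3 → Fin t)
         (row-inj : Injective _≡_ _≡_ row) (col-inj : Injective _≡_ _≡_ col) where

  private
    rows-distinct : row 1F ≢ row 0F
    rows-distinct = (λ ()) ∘ row-inj

    cols-distinct : ∀ {k k′} → k ≢ k′ → col k ≢ col k′
    cols-distinct k≢k′ = k≢k′ ∘ col-inj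

    second-row : ∀ {k k′} → k ≢ k′ → c (row 0F) (col k) ≡ 1F → c (row 0F) (col k′) ≡ 1F →
                 K12-or-P4 c ⊎ ∃₂ λ j k → c (row j) (col k) ≡ 2F
    second-row {k} {k′} k≢k′ e e′ with c (row 1F) (col k) in f | c (row 1F) (col k′) in f′
    ... | 2F | _  = inj₂ (1F , k , f)
    ... | _  | 2F = inj₂ (1F , k′ , f′)
    ... | 1F | _  = inj₁ (inj₂ (zigzag c rows-distinct (cols-distinct k≢k′) f e e′))
    ... | _  | 1F = inj₁ (inj₂ (zigzag c rows-distinct (cols-distinct (≢-sym k≢k′)) f′ e′ e))
    ... | 0F | 0F = inj₁ (inj₁ (cherry c (cols-distinct k≢k′) f f′))

  K12-or-P4-or-colour₂-in-2×3 : K12-or-P4 c ⊎ ∃₂ λ j k → c (row j) (col k) ≡ 2F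
  K12-or-P4-or-colour₂-in-2×3
    with c (row 0F) (col 0F) in e₀ | c (row 0F) (col 1F) in e₁ | c (row 0F) (col 2F) in e₂
  ... | 2F | _  | _  = inj₂ (0F , 0F , e₀)
  ... | _  | 2F | _  = inj₂ (0F , 1F , e₁)
  ... | _  | _  | 2F = inj₂ (0F , 2F , e₂)
  ... | 0F | 0F | _  = inj₁ (inj₁ (cherry c (cols-distinct λ ()) e₀ e₁))
  ... | 0F | _  | 0F = inj₁ (inj₁ (cherry c (cols-distinct λ ()) e₀ e₂))
  ... | _  | 0F | 0F = inj₁ (inj₁ (cherry c (cols-distinct λ ()) e₁ e₂))
  ... | 1F | 1F | _  = second-row (λ ()) e₀ e₁
  ... | 1F | _  | 1F = second-row (λ ()) e₀ e₂
  ... | _  | 1F | 1F = second-row (λ ()) e₁ e₂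

record ColouredMatching (c : Colouring t) (i : Fin 3) (m : ℕ) : Set where
  field
    row col       : Fin m → Fin t
    row-injective : Injective _≡_ _≡_ row
    col-injective : Injective _≡_ _≡_ col
    coloured      : ∀ k → c (row k) (col k) ≡ i

  copy : HasMonoCopy c i (matching m)
  copy = vertex , injective , coloured
    where
    vertex : Fin m × Fin 2 → BipVertex t
    vertex (k , 0F) = inj₁ (row k)
    vertex (k , 1F) = inj₂ (col k)
    injective : Injective _≡_ _≡_ vertex
    injective {_ , 0F} {_ , 0F} eq = cong (_, 0F) (row-injective (inj₁-injective eq))
    injective {_ , 0F} {_ , 1F} ()
    injective {_ , 1F} {_ , 0F} ()
    injective {_ , 1F} {_ , 1F} eq = cong (_, 1F) (col-injective (inj₂-injective eq))

pairing : {c : Colouring t} {a a′ b b′ : Fin t} → a ≢ a′ → b ≢ b′ →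
          c a b ≡ i → c a′ b′ ≡ i → ColouredMatching c i 2
pairing {a = a} {a′} {b} {b′} a≢a′ b≢b′ ab a′b′ = record
  { row = a ∷ a′ ∷ []
  ; col = b ∷ b′ ∷ []
  ; row-injective = pair-injective a≢a′
  ; col-injective = pair-injective b≢b′
  ; coloured = λ { 0F → ab ; 1F → a′b′ }
  }
  where
  pair-injective : {x y : Fin t} → x ≢ y → Injective _≡_ _≡_ (x ∷ y ∷ [])
  pair-injective x≢y = ∷-injective (λ { 0F → ≢-sym x≢y }) (∷-injective (λ ()) []-injective)

extend : {c : Colouring (suc t)} {a b : Fin (suc t)} → c a b ≡ i →
         ColouredMatching (restrict c (punchIn a) (punchIn b)) i m → ColouredMatching c i (suc m)
extend {a = a} {b} ab M = record
  { row = a ∷ punchIn a ∘ row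
  ; col = b ∷ punchIn b ∘ col
  ; row-injective = ∷-injective (punchInᵢ≢i a ∘ row) (row-injective ∘ punchIn-injective a _ _)
  ; col-injective = ∷-injective (punchInᵢ≢i b ∘ col) (col-injective ∘ punchIn-injective b _ _)
  ; coloured = λ { 0F → ab ; (suc k) → coloured k }
  }
  where open ColouredMatching M

Forced : Colouring t → ℕ → Set
Forced c m = K12-or-P4 c ⊎ ColouredMatching c 2F m

K12-or-P4-or-colour₂ : (c : Colouring (3 + n)) → K12-or-P4 c ⊎ ∃₂ λ a b → c a b ≡ 2F
K12-or-P4-or-colour₂ {n} c =
  Sum.map₂ (λ (_ , _ , e) → _ , _ , e)
    (K12-or-P4-or-colour₂-in-2×3 c (_↑ˡ suc n) (_↑ˡ n) (↑ˡ-injective (suc n) _ _) (↑ˡ-injective n _ _))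

-- Take a colour-2 edge ab and a colour-2 edge a′b′ with a′ ≠ a. If b′ ≠ b we are done;
-- otherwise take a colour-2 edge a″b″ with b″ ≠ b, and pair it with ab or, if a″ = a, with a′b.
K₃,₃-forced : (c : Colouring 3) → Forced c 2
K₃,₃-forced c with K12-or-P4-or-colour₂ c
... | inj₁ bad = inj₁ bad
... | inj₂ (a , b , ab)
  with K12-or-P4-or-colour₂-in-2×3 c (punchIn a) id (punchIn-injective a _ _) id
...   | inj₁ bad = inj₁ bad
...   | inj₂ (j , b′ , a′b′) with b′ ≟ b
...     | no b′≢b = inj₂ (pairing (≢-sym (punchInᵢ≢i a j)) (≢-sym b′≢b) ab a′b′)
...     | yes refl
  with K12-or-P4-or-colour₂-in-2×3 (flip c) (punchIn b) id (punchIn-injective b _ _) id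
...       | inj₁ bad = inj₁ (K12-or-P4-transfer (transposition c) bad)
...       | inj₂ (k , a″ , a″b″) with a″ ≟ a
...         | no a″≢a = inj₂ (pairing (≢-sym a″≢a) (≢-sym (punchInᵢ≢i b k)) ab a″b″)
...         | yes refl = inj₂ (pairing (punchInᵢ≢i a j) (≢-sym (punchInᵢ≢i b k)) a′b′ a″b″)

forced : ∀ m (c : Colouring (2 + m + 1)) → Forced c (2 + m)
forced zero    c = K₃,₃-forced c
forced (suc m) c with K12-or-P4-or-colour₂ c
... | inj₁ bad = inj₁ bad
... | inj₂ (a , b , ab) =
  Sum.map (K12-or-P4-transfer (restriction c (punchIn-injective a _ _) (punchIn-injective b _ _)))
          (extend ab)
          (forced m (restrict c (punchIn a) (punchIn b)))

arrows : ∀ m → Arrows (2 + m + 1) K12 P4 (matching (2 + m))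
arrows m c with forced m c
... | inj₁ (inj₁ k12) = 0F , k12
... | inj₁ (inj₂ p4)  = 1F , p4
... | inj₂ M          = 2F , ColouredMatching.copy M

matching-≤-cover : {c : Colouring t} (γ : Fin s → BipVertex t) →
                   (∀ x y → EdgeOfColour c x y i → ∃ λ k → x ≡ γ k ⊎ y ≡ γ k) →
                   HasMonoCopy c i (matching m) → m ≤ s
matching-≤-cover {s = s} {m = m} γ cover (f , f-inj , f-edge) = injective⇒≤ g-inj
  where
  g : Fin m → Fin s
  g e = proj₁ (cover _ _ (f-edge e))
  endpoint : ∀ e → ∃ λ j → f (e , j) ≡ γ (g e)
  endpoint e with cover _ _ (f-edge e)
  ... | _ , inj₁ eq = 0F , eq
  ... | _ , inj₂ eq = 1F , eq
  g-inj : Injective _≡_ _≡_ g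
  g-inj {e} {e′} eq with endpoint e | endpoint e′
  ... | _ , p | _ , p′ = cong proj₁ (f-inj (trans p (trans (cong γ eq) (sym p′))))

P4⇒matching₂ : {c : Colouring t} → HasMonoCopy c i P4 → HasMonoCopy c i (matching 2)
P4⇒matching₂ (f , f-inj , f-edge) =
  f ∘ uncurry combine ,
  (λ eq → ×-≡,≡→≡ (combine-injective _ _ _ _ (f-inj eq))) ,
  λ { 0F → f-edge 0F ; 1F → f-edge 2F }

extremalColouring : Colouring (suc t)
extremalColouring 0F      _ = 1F
extremalColouring (suc _) _ = 2F

no-arrows-below : t < m → ¬ Arrows (suc t) K12 P4 (matching m)
no-arrows-below t<m arrows with arrows extremalColouring
... | 0F , _ , _ , f-edge = no-colour₀ _ _ (f-edge 0F)
  where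
  no-colour₀ : ∀ x y → ¬ EdgeOfColour (extremalColouring {t}) x y 0F
  no-colour₀ (inj₁ 0F)      (inj₂ _) ()
  no-colour₀ (inj₁ (suc _)) (inj₂ _) ()
  no-colour₀ (inj₂ _) (inj₁ 0F)      ()
  no-colour₀ (inj₂ _) (inj₁ (suc _)) ()
... | 1F , p4 = ≤⇒≯ (matching-≤-cover (λ (_ : Fin 1) → inj₁ 0F) cover₁ (P4⇒matching₂ p4)) (s≤s (s≤s z≤n))
  where
  cover₁ : ∀ x y → EdgeOfColour (extremalColouring {t}) x y 1F → ∃ λ k → x ≡ inj₁ 0F ⊎ y ≡ inj₁ 0F
  cover₁ (inj₁ 0F) (inj₂ _) _ = 0F , inj₁ refl
  cover₁ (inj₂ _) (inj₁ 0F) _ = 0F , inj₂ refl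
... | 2F , M = ≤⇒≯ (matching-≤-cover (inj₁ ∘ suc) cover₂ M) t<m
  where
  cover₂ : ∀ x y → EdgeOfColour (extremalColouring {t}) x y 2F → ∃ λ k → x ≡ inj₁ (suc k) ⊎ y ≡ inj₁ (suc k)
  cover₂ (inj₁ (suc a)) (inj₂ _) _ = a , inj₁ refl
  cover₂ (inj₂ _) (inj₁ (suc a)) _ = a , inj₂ refl

lemma1 : (n : ℕ) → 2 ≤ n → M2≡ K12 P4 (matching n) (n + 1)
lemma1 (suc (suc m)) (s≤s (s≤s z≤n)) =
  s≤s z≤n ,
  arrows m ,
  λ { (suc t) _ t+1<n+1 → no-arrows-below (m<1+n⇒m≤n (subst (suc t <_) (+-comm (suc (suc m)) 1) t+1<n+1)) }
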